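{- Let $p$ be a prime and let $f \in \mathbb{Q}[x]$ have $p$-integral coefficients, with $f(0) = f(f(0))$. Suppose that for some positive integers $n > k$ and some $c \in \mathbb{Z}_{(p)}$ both $f^{\circ k}(c)$ and $f^{\circ n}(c)$ are divisible by $p$. Then $p$ divides $f(0)$.
   Context: $f^{\circ n}$ is the $n$-th iterate of $f$; $\mathbb{Z}_{(p)}$ is the localization of $\mathbb{Z}$ at the prime $p$, and divisibility by $p$ is in $\mathbb{Z}_{(p)}$. -}

module Defs where

open import Data.Nat using (ℕ; zero; suc)
open import Data.Nat.Divisibility using (_∣_)
open import Data.Integer using (+_)
open import Data.Rational using (ℚ; 0ℚ; _+_; _*_; _/_)
open import Data.List using (List; []; _∷_)
open import Data.Product using (Σ; _×_)
open import Relation.Nullary using (¬_)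
open import Relation.Binary.PropositionalEquality using (_≡_)

PIntegral : ℕ → ℚ → Set
PIntegral p q = ¬ (p ∣ ℚ.denominatorℕ q)

-- Polynomials in ℚ[x] as coefficient lists, constant term first:
-- a₀ ∷ a₁ ∷ … ∷ aₘ ∷ []  represents  a₀ + a₁ x + … + aₘ xᵐ.
Poly : Set
Poly = List ℚ

eval : Poly → ℚ → ℚ
eval []       x = 0ℚ
eval (a ∷ as) x = a + x * eval as x

iter : (ℚ → ℚ) → ℕ → ℚ → ℚ
iter f zero    x = x
iter f (suc n) x = f (iter f n x)

PDivides : (p : ℕ) → ℚ → Set
PDivides p x = Σ ℚ (λ y → PIntegral p y × x ≡ (+ p / 1) * y)

{-# OPTIONS --safe #-}
-- Iterates of a p-integral polynomial respect congruence modulo p in ℤ_(p).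
-- Since f(0) is a fixed point of f, every iterate f^{∘m}(0) with m ≥ 1 equals
-- f(0). Writing n = m + k with m ≥ 1 and u = f^{∘k}(c) ≡ 0, we get
-- 0 ≡ f^{∘n}(c) = f^{∘m}(u) ≡ f^{∘m}(0) = f(0) modulo p.
module Submission where

open import Defs
open import Data.Nat using (ℕ; _<_; zero; suc; NonZero; nonTrivial⇒≢1)
import Data.Nat as ℕ
import Data.Nat.Properties as ℕ
open import Data.Nat.GCD using (gcd)
open import Data.Nat.Divisibility using (_∣_; divides; ∣-trans; ∣1⇒≡1)
open import Data.Nat.Primality using (Prime; euclidsLemma; prime⇒nonTrivial)
open import Data.Integer using (+_)
import Data.Integer as ℤ
import Data.Integer.Properties as ℤ
open import Data.Rational using (ℚ; 0ℚ; mkℚ; _+_; _-_; _*_; _/_; -_)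
open import Data.Rational.Properties using (↧-/; ↧-neg; +-identityʳ)
open import Data.Rational.Solver using (module +-*-Solver)
open import Data.List using (_∷_)
open import Data.List.Relation.Unary.All using (All; []; _∷_)
open import Data.Product using (∃; _,_)
open import Data.Sum using (inj₁; inj₂)
open import Function using (_∘_)
open import Relation.Nullary using (¬_)
open import Relation.Binary.PropositionalEquality
  using (_≡_; refl; sym; trans; cong; cong₂; subst; subst₂; module ≡-Reasoning)

open +-*-Solver
open ≡-Reasoning

denominator-/-∣ : ∀ i n .{{_ : NonZero n}} → ℚ.denominatorℕ (i / n) ∣ n
denominator-/-∣ i n = divides (gcd ℤ.∣ i ∣ n) (sym (ℤ.+-injective (begin
  + (gcd ℤ.∣ i ∣ n ℕ.* ℚ.denominatorℕ (i / n))  ≡⟨ cong +_ (ℕ.*-comm (gcd ℤ.∣ i ∣ n) _) ⟩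
  + (ℚ.denominatorℕ (i / n) ℕ.* gcd ℤ.∣ i ∣ n)  ≡⟨ ℤ.pos-* (ℚ.denominatorℕ (i / n)) _ ⟩
  ℚ.denominator (i / n) ℤ.* + gcd ℤ.∣ i ∣ n     ≡⟨ ↧-/ i n ⟩
  + n                                           ∎)))

iter-+ : ∀ (f : ℚ → ℚ) m k x → iter f (m ℕ.+ k) x ≡ iter f m (iter f k x)
iter-+ f zero    k x = refl
iter-+ f (suc m) k x = cong f (iter-+ f m k x)

iter-suc : ∀ (f : ℚ → ℚ) m x → iter f (suc m) x ≡ iter f m (f x)
iter-suc f m x = trans (cong (λ j → iter f j x) (ℕ.+-comm 1 m)) (iter-+ f m 1 x)

iter-fixedPoint : ∀ (f : ℚ → ℚ) {a} → f a ≡ a → ∀ m → iter f m a ≡ a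
iter-fixedPoint f fa≡a zero    = refl
iter-fixedPoint f fa≡a (suc m) = trans (cong f (iter-fixedPoint f fa≡a m)) fa≡a

iter-<-split : ∀ (f : ℚ → ℚ) {k n} → k < n → ∀ x →
  ∃ λ m → iter f n x ≡ iter f (suc m) (iter f k x)
iter-<-split f {k} k<n x with ℕ.m≤n⇒∃[o]m+o≡n k<n
... | m , refl = m , trans (cong (λ j → iter f (suc j) x) (ℕ.+-comm k m)) (iter-+ f (suc m) k x)

module ModPrime {p : ℕ} (p-prime : Prime p) where

  private
    P : ℚ
    P = + p / 1

    p∤1 : ¬ (p ∣ 1)
    p∤1 = nonTrivial⇒≢1 {{prime⇒nonTrivial p-prime}} ∘ ∣1⇒≡1

  PIntegral-0 : PIntegral p 0ℚ
  PIntegral-0 = p∤1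

  PIntegral-neg : ∀ q → PIntegral p q → PIntegral p (- q)
  PIntegral-neg q = subst (λ d → ¬ (p ∣ d)) (sym (ℤ.+-injective (↧-neg q)))

  -- The denominator of a sum or product divides the product of the denominators.
  PIntegral-+ : ∀ q r → PIntegral p q → PIntegral p r → PIntegral p (q + r)
  PIntegral-+ q@(mkℚ _ _ _) r@(mkℚ _ _ _) iq ir p∣d
    with euclidsLemma (ℚ.denominatorℕ q) (ℚ.denominatorℕ r) p-prime
           (∣-trans p∣d (denominator-/-∣ (ℚ.numerator q ℤ.* ℚ.denominator r ℤ.+ ℚ.numerator r ℤ.* ℚ.denominator q) _))
  ... | inj₁ p∣dq = iq p∣dq
  ... | inj₂ p∣dr = ir p∣dr

  PIntegral-* : ∀ q r → PIntegral p q → PIntegral p r → PIntegral p (q * r)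
  PIntegral-* q@(mkℚ _ _ _) r@(mkℚ _ _ _) iq ir p∣d
    with euclidsLemma (ℚ.denominatorℕ q) (ℚ.denominatorℕ r) p-prime
           (∣-trans p∣d (denominator-/-∣ (ℚ.numerator q ℤ.* ℚ.numerator r) _))
  ... | inj₁ p∣dq = iq p∣dq
  ... | inj₂ p∣dr = ir p∣dr

  eval-PIntegral : ∀ {f x} → All (PIntegral p) f → PIntegral p x → PIntegral p (eval f x)
  eval-PIntegral []         ix = PIntegral-0
  eval-PIntegral {a ∷ as} {x} (ia ∷ ias) ix =
    PIntegral-+ a (x * eval as x) ia (PIntegral-* x (eval as x) ix (eval-PIntegral ias ix))

  iter-PIntegral : ∀ {f x} → All (PIntegral p) f → PIntegral p x →
    ∀ m → PIntegral p (iter (eval f) m x)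
  iter-PIntegral af ix zero    = ix
  iter-PIntegral af ix (suc m) = eval-PIntegral af (iter-PIntegral af ix m)

  infix 4 _≡_[mod-p]
  record _≡_[mod-p] (x y : ℚ) : Set where
    constructor mod-p
    field p∣x-y : PDivides p (x - y)

  PDivides⇒≡0 : ∀ {x} → PDivides p x → x ≡ 0ℚ [mod-p]
  PDivides⇒≡0 {x} = mod-p ∘ subst (PDivides p) (sym (+-identityʳ x))

  ≡0⇒PDivides : ∀ {x} → x ≡ 0ℚ [mod-p] → PDivides p x
  ≡0⇒PDivides {x} (mod-p p∣x-0) = subst (PDivides p) (+-identityʳ x) p∣x-0

  mod-refl : ∀ {x} → x ≡ x [mod-p]
  mod-refl {x} = mod-p (0ℚ , PIntegral-0 ,
    solve 2 (λ X Q → X :- X := Q :* con 0ℚ) refl x P)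

  mod-sym : ∀ {x y} → x ≡ y [mod-p] → y ≡ x [mod-p]
  mod-sym {x} {y} (mod-p (w , iw , x-y≡Pw)) = mod-p (- w , PIntegral-neg w iw , (begin
    y - x        ≡⟨ solve 2 (λ X Y → Y :- X := :- (X :- Y)) refl x y ⟩
    - (x - y)    ≡⟨ cong -_ x-y≡Pw ⟩
    - (P * w)    ≡⟨ solve 2 (λ Q W → :- (Q :* W) := Q :* (:- W)) refl P w ⟩
    P * - w      ∎))

  mod-trans : ∀ {x y z} → x ≡ y [mod-p] → y ≡ z [mod-p] → x ≡ z [mod-p]
  mod-trans {x} {y} {z} (mod-p (v , iv , x-y≡Pv)) (mod-p (w , iw , y-z≡Pw)) =
    mod-p (v + w , PIntegral-+ v w iv iw , (begin
    x - z                ≡⟨ solve 3 (λ X Y Z → X :- Z := (X :- Y) :+ (Y :- Z)) refl x y z ⟩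
    (x - y) + (y - z)    ≡⟨ cong₂ _+_ x-y≡Pv y-z≡Pw ⟩
    P * v + P * w        ≡⟨ solve 3 (λ Q V W → Q :* V :+ Q :* W := Q :* (V :+ W)) refl P v w ⟩
    P * (v + w)          ∎))

  mod-+-cong : ∀ {x x′ y y′} → x ≡ x′ [mod-p] → y ≡ y′ [mod-p] → x + y ≡ x′ + y′ [mod-p]
  mod-+-cong {x} {x′} {y} {y′} (mod-p (v , iv , x-x′≡Pv)) (mod-p (w , iw , y-y′≡Pw)) =
    mod-p (v + w , PIntegral-+ v w iv iw , (begin
    (x + y) - (x′ + y′)    ≡⟨ solve 4 (λ X X′ Y Y′ → (X :+ Y) :- (X′ :+ Y′) := (X :- X′) :+ (Y :- Y′)) refl x x′ y y′ ⟩
    (x - x′) + (y - y′)    ≡⟨ cong₂ _+_ x-x′≡Pv y-y′≡Pw ⟩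
    P * v + P * w          ≡⟨ solve 3 (λ Q V W → Q :* V :+ Q :* W := Q :* (V :+ W)) refl P v w ⟩
    P * (v + w)            ∎))

  -- x y - x′ y′ = (x - x′) y + x′ (y - y′), so only y and x′ need to be p-integral.
  mod-*-cong : ∀ {x x′ y y′} → PIntegral p x′ → PIntegral p y →
    x ≡ x′ [mod-p] → y ≡ y′ [mod-p] → x * y ≡ x′ * y′ [mod-p]
  mod-*-cong {x} {x′} {y} {y′} ix′ iy (mod-p (v , iv , x-x′≡Pv)) (mod-p (w , iw , y-y′≡Pw)) =
    mod-p (v * y + x′ * w , PIntegral-+ (v * y) (x′ * w) (PIntegral-* v y iv iy) (PIntegral-* x′ w ix′ iw) , (begin
    x * y - x′ * y′                ≡⟨ solve 4 (λ X X′ Y Y′ → X :* Y :- X′ :* Y′ := (X :- X′) :* Y :+ X′ :* (Y :- Y′)) refl x x′ y y′ ⟩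
    (x - x′) * y + x′ * (y - y′)   ≡⟨ cong₂ (λ s t → s * y + x′ * t) x-x′≡Pv y-y′≡Pw ⟩
    P * v * y + x′ * (P * w)       ≡⟨ solve 5 (λ Q V Y X′ W → Q :* V :* Y :+ X′ :* (Q :* W) := Q :* (V :* Y :+ X′ :* W)) refl P v y x′ w ⟩
    P * (v * y + x′ * w)           ∎))

  eval-cong : ∀ {f x y} → All (PIntegral p) f → PIntegral p x → PIntegral p y →
    x ≡ y [mod-p] → eval f x ≡ eval f y [mod-p]
  eval-cong []         ix iy x≡y = mod-refl
  eval-cong {a ∷ _} (ia ∷ ias) ix iy x≡y =
    mod-+-cong (mod-refl {a}) (mod-*-cong iy (eval-PIntegral ias ix) x≡y (eval-cong ias ix iy x≡y))

  iter-cong : ∀ {f x y} → All (PIntegral p) f → PIntegral p x → PIntegral p y →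
    x ≡ y [mod-p] → ∀ m → iter (eval f) m x ≡ iter (eval f) m y [mod-p]
  iter-cong af ix iy x≡y zero    = x≡y
  iter-cong af ix iy x≡y (suc m) =
    eval-cong af (iter-PIntegral af ix m) (iter-PIntegral af iy m) (iter-cong af ix iy x≡y m)

lemma4p4 : (p : ℕ) → Prime p → (f : Poly) → All (PIntegral p) f →
    eval f 0ℚ ≡ eval f (eval f 0ℚ) →
    (k n : ℕ) → 0 < k → k < n → (c : ℚ) → PIntegral p c →
    PDivides p (iter (eval f) k c) → PDivides p (iter (eval f) n c) →
    PDivides p (eval f 0ℚ)
lemma4p4 p p-prime f af f0-fixed k n _ k<n c ic p∣fᵏc p∣fⁿc
  with iter-<-split (eval f) k<n c
... | m , fⁿc≡fᵐ⁺¹fᵏc = ≡0⇒PDivides (mod-trans f0≡fⁿc (PDivides⇒≡0 p∣fⁿc))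
  where
  open ModPrime p-prime

  fᵐ⁺¹0≡f0 : iter (eval f) (suc m) 0ℚ ≡ eval f 0ℚ
  fᵐ⁺¹0≡f0 = trans (iter-suc (eval f) m 0ℚ) (iter-fixedPoint (eval f) (sym f0-fixed) m)

  fᵐ⁺¹fᵏc≡fᵐ⁺¹0 : iter (eval f) (suc m) (iter (eval f) k c) ≡ iter (eval f) (suc m) 0ℚ [mod-p]
  fᵐ⁺¹fᵏc≡fᵐ⁺¹0 = iter-cong af (iter-PIntegral af ic k) PIntegral-0 (PDivides⇒≡0 p∣fᵏc) (suc m)

  f0≡fⁿc : eval f 0ℚ ≡ iter (eval f) n c [mod-p]
  f0≡fⁿc = subst₂ _≡_[mod-p] fᵐ⁺¹0≡f0 (sym fⁿc≡fᵐ⁺¹fᵏc) (mod-sym fᵐ⁺¹fᵏc≡fᵐ⁺¹0)
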